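{- For all positive integers $k$ and $n$, \[(k-1)\,\Pi'_{q,k}(n) \leq \sum_{\substack{p \in \mathcal{I}_q \\ \deg p \leq n/2}} \Pi'_{q,k-1}(n-\deg p).\]
   Context: $q$ is a prime power, $\mathcal{I}_q$ is the set of monic irreducible polynomials in $\mathbb{F}_q[x]$. For integers $k\ge 0$, $m \ge 0$, $\Pi'_{q,k}(m)$ denotes the number of squarefree monic polynomials in $\mathbb{F}_q[x]$ of degree $m$ with exactly $k$ irreducible factors. -}

module Defs where

open import Data.Nat using (ℕ; zero; suc; _+_; _*_; _∸_; _^_; _≤_; _<_; _≤?_; s≤s; z≤n)
open import Data.Nat.Properties using (≤-pred; <-irrefl; ≤-refl; m≤n⇒m<n∨m≡n; ≤-trans; m≤m+n)
open import Data.Nat.Primality using (Prime)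
open import Data.Fin using (Fin)
import Data.Fin.Properties as FinP
open import Data.Vec using (Vec; []; _∷_; toList)
open import Data.List using (List; []; _∷_; _++_; map; concatMap; filter; length; upTo)
open import Data.Nat.ListAction using (sum)
import Data.List.Properties as ListP
open import Data.Product using (Σ; ∃; ∃₂; _×_; _,_; proj₁; proj₂)
open import Data.Sum using (_⊎_; inj₁; inj₂)
open import Relation.Nullary using (Dec; yes; no; ¬_)
open import Relation.Nullary.Decidable using (_×-dec_; _⊎-dec_; _→-dec_; ¬?)
open import Relation.Binary.PropositionalEquality using (_≡_; _≢_; refl)
open import Algebra.Core using (Op₁; Op₂)
open import Algebra.Structures using (IsCommutativeRing)

IsPrimePower : ℕ → Set
IsPrimePower q = ∃₂ λ p e → Prime p × q ≡ p ^ suc e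

-- A finite field with q elements, presented (up to isomorphism) as a
-- field structure on the carrier Fin q, with propositional equality.

record FiniteField (q : ℕ) : Set where
  infixl 7 _⊗_
  infixl 6 _⊕_
  field
    _⊕_ _⊗_ : Op₂ (Fin q)
    ⊖_ : Op₁ (Fin q)
    0# 1# : Fin q
    isCommutativeRing : IsCommutativeRing _≡_ _⊕_ _⊗_ ⊖_ 0# 1#
    0≢1 : 0# ≢ 1#
    inverse : ∀ x → x ≢ 0# → ∃ λ y → x ⊗ y ≡ 1#

∃Vec? : ∀ {q} n {P : Vec (Fin q) n → Set} → (∀ v → Dec (P v)) → Dec (Σ (Vec (Fin q) n) P)
∃Vec? zero P? with P? []
... | yes p = yes ([] , p)
... | no ¬p = no λ { ([] , p) → ¬p p }
∃Vec? (suc n) {P} P? with FinP.any? (λ x → ∃Vec? n (λ v → P? (x ∷ v)))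
... | yes (x , v , p) = yes (x ∷ v , p)
... | no ¬p = no λ { (x ∷ v , p) → ¬p (x , v , p) }

∀Vec? : ∀ {q} n {P : Vec (Fin q) n → Set} → (∀ v → Dec (P v)) → Dec (∀ v → P v)
∀Vec? zero P? with P? []
... | yes p = yes λ { [] → p }
... | no ¬p = no λ f → ¬p (f [])
∀Vec? (suc n) {P} P? with FinP.all? (λ x → ∀Vec? n (λ v → P? (x ∷ v)))
... | yes f = yes λ { (x ∷ v) → f x v }
... | no ¬f = no λ f → ¬f (λ x v → f (x ∷ v))

private
  ∀< : ∀ {P : ℕ → Set} → (∀ e → Dec (P e)) → ∀ k → Dec (∀ e → e < k → P e)
  ∀< P? zero = yes λ e ()
  ∀< {P} P? (suc k) with ∀< P? k | P? k
  ... | no ¬f | _ = no λ f → ¬f (λ e e<k → f e (≤-trans e<k (Data.Nat.Properties.n≤1+n _)))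
    where import Data.Nat.Properties
  ... | yes _ | no ¬p = no λ f → ¬p (f k ≤-refl)
  ... | yes f | yes p = yes λ e e<sk → helper e (m≤n⇒m<n∨m≡n (≤-pred e<sk))
    where
      helper : ∀ e → e < k ⊎ e ≡ k → P e
      helper e (inj₁ e<k) = f e e<k
      helper e (inj₂ refl) = p

∀ℕ-bounded? : ∀ {P : ℕ → Set} m → (∀ e → m < e → P e) → (∀ e → Dec (P e)) → Dec (∀ e → P e)
∀ℕ-bounded? {P} m big P? with ∀< P? (suc m)
... | no ¬f = no λ f → ¬f (λ e _ → f e)
... | yes f = yes λ e → go e (e Data.Nat.≤? m)
  where
    go : ∀ e → Dec (e ≤ m) → P e
    go e (yes e≤m) = f e (s≤s e≤m)
    go e (no e≰m) = big e (Data.Nat.Properties.≰⇒> e≰m)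
      where import Data.Nat.Properties

module _ {q : ℕ} (F : FiniteField q) where
  open FiniteField F

  -- Coefficient lists (lowest degree first) and their arithmetic.
  addL : List (Fin q) → List (Fin q) → List (Fin q)
  addL [] ys = ys
  addL (x ∷ xs) [] = x ∷ xs
  addL (x ∷ xs) (y ∷ ys) = (x ⊕ y) ∷ addL xs ys

  mulL : List (Fin q) → List (Fin q) → List (Fin q)
  mulL [] ys = []
  mulL (x ∷ xs) ys = addL (map (x ⊗_) ys) (0# ∷ mulL xs ys)

  -- A monic polynomial of degree d is given by its d lower coefficients
  -- a₀ … a_{d-1}; its full coefficient list appends the leading 1.
  Monic : ℕ → Set
  Monic d = Vec (Fin q) d

  full : ∀ {d} → Monic d → List (Fin q)
  full v = toList v ++ (1# ∷ [])

  allMonic : ∀ d → List (Monic d)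
  allMonic zero = [] ∷ []
  allMonic (suc d) = concatMap (λ x → map (x ∷_) (allMonic d)) (Data.List.allFin q)

  -- g (a monic polynomial of degree d, given by coefficient list) divides
  -- the monic f of degree m: f = g * h for some (necessarily monic,
  -- degree m - d) polynomial h.
  Divides : ∀ {m} → ℕ → List (Fin q) → Monic m → Set
  Divides {m} d g f = d ≤ m × Σ (Monic (m ∸ d)) λ h → mulL g (full h) ≡ full f

  divides? : ∀ {m} d g (f : Monic m) → Dec (Divides d g f)
  divides? {m} d g f =
    (d ≤? m) ×-dec ∃Vec? (m ∸ d) (λ h → ListP.≡-dec FinP._≟_ (mulL g (full h)) (full f))

  -- Monic irreducible: positive degree, and the only monic divisors are
  -- of degree 0 (i.e. 1) or of full degree (i.e. p itself).
  Irreducible : ∀ {d} → Monic d → Set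
  Irreducible {d} p = 1 ≤ d × (∀ e (g : Monic e) → Divides e (full g) p → e ≡ 0 ⊎ e ≡ d)

  irreducible? : ∀ {d} (p : Monic d) → Dec (Irreducible p)
  irreducible? {d} p = (1 ≤? d) ×-dec ∀ℕ-bounded? d big
    (λ e → ∀Vec? e (λ g → divides? e (full g) p →-dec
       ((e Data.Nat.≟ 0) ⊎-dec (e Data.Nat.≟ d))))
    where
      big : ∀ e → d < e → ∀ (g : Monic e) → Divides e (full g) p → e ≡ 0 ⊎ e ≡ d
      big e d<e g (e≤d , _) = Data.Empty.⊥-elim (<-irrefl refl (≤-trans d<e e≤d))
        where import Data.Empty

  Squarefree : ∀ {m} → Monic m → Set
  Squarefree f = ∀ d → 1 ≤ d → (p : Monic d) → ¬ Divides (d + d) (mulL (full p) (full p)) f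

  squarefree? : ∀ {m} (f : Monic m) → Dec (Squarefree f)
  squarefree? {m} f = ∀ℕ-bounded? m big
    (λ d → (1 ≤? d) →-dec ∀Vec? d (λ p → ¬? (divides? (d + d) (mulL (full p) (full p)) f)))
    where
      big : ∀ d → m < d → 1 ≤ d → (p : Monic d) → ¬ Divides (d + d) (mulL (full p) (full p)) f
      big d m<d _ p (dd≤m , _) = <-irrefl refl (≤-trans m<d (≤-trans (m≤m+n d d) dd≤m))

  numIrrFactors : ∀ {m} → Monic m → ℕ
  numIrrFactors {m} f = sum (map (λ d → length (filter
      (λ p → irreducible? p ×-dec divides? d (full p) f) (allMonic d))) (upTo (suc m)))

  Π′ : ℕ → ℕ → ℕ
  Π′ k m = length (filter (λ f → squarefree? f ×-dec (numIrrFactors f Data.Nat.≟ k)) (allMonic m))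

  -- Σ_{p ∈ I_q, deg p ≤ n/2} Π'_{q,k-1}(n - deg p)   (with j = k - 1)
  irreduciblesUpTo : ℕ → List (Σ ℕ Monic)
  irreduciblesUpTo n = concatMap (λ d → map (d ,_) (filter irreducible? (allMonic d)))
    (filter (λ d → (2 * d) ≤? n) (upTo (suc n)))

  rhsSum : ℕ → ℕ → ℕ
  rhsSum j n = sum (map (λ dp → Π′ j (n ∸ proj₁ dp)) (irreduciblesUpTo n))

module Submission where

-- Idea (double counting).  Let S be the set of squarefree monic f of degree n
-- with exactly k irreducible factors.  Two distinct irreducible factors of f
-- have degrees summing to at most n, so at most one factor of f has degree
-- > n/2; hence every f ∈ S has at least k - 1 irreducible factors p with
-- deg p ≤ n/2.  Counting the pairs (f, p) with p ∣ f, deg p ≤ n/2 by f gives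
-- at least (k - 1)·|S|; counting them by p gives Σ_p #{f ∈ S : p ∣ f}, and
-- f ↦ f / p injects {f ∈ S : p ∣ f} into the squarefree polynomials of degree
-- n - deg p with k - 1 irreducible factors.

open import Defs
open import Data.Nat using (ℕ; _*_; _∸_; _≤_)

module Counting where

  open import Data.Nat using (zero; suc; _+_; _<_; _≟_; s≤s; z≤n)
  open import Data.Nat.Properties
    using (≤-reflexive; +-comm; +-assoc; +-mono-≤; +-identityʳ; *-zeroʳ; *-suc; m≤n+m; ≤-pred;
           <-irrefl; m≤n⇒m<n∨m≡n)
  open import Data.List using (List; []; _∷_; _++_; map; length; filter; concatMap; applyUpTo; upTo)
  open import Data.List.Properties using (filter-++; length-++)
  open import Data.Nat.ListAction using (sum)
  open import Data.List.Membership.Propositional using (_∈_)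
  open import Data.List.Membership.Propositional.Properties using (∈-upTo⁻; ∈-filter⁺)
  open import Data.List.Relation.Unary.Any using (here; there)
  open import Data.List.Relation.Unary.All as All using (All)
  open import Data.List.Relation.Unary.AllPairs using ([]; _∷_)
  open import Data.List.Relation.Unary.Unique.Propositional using (Unique)
  open import Data.Product using (Σ; ∃; _×_; _,_)
  open import Data.Sum using (_⊎_; inj₁; inj₂)
  open import Data.Empty using (⊥-elim)
  open import Relation.Nullary using (Dec; yes; no; ¬_)
  open import Relation.Nullary.Decidable using (_×-dec_; ¬?)
  open import Relation.Unary using (Decidable)
  open import Relation.Binary.PropositionalEquality using (_≡_; _≢_; refl; sym; trans; cong; cong₂; subst)
  open Relation.Binary.PropositionalEquality.≡-Reasoning

  private
    variable
      A B : Set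

  indicator : {P : Set} → Dec P → ℕ
  indicator (yes _) = 1
  indicator (no _) = 0

  count : {P : A → Set} → Decidable P → List A → ℕ
  count P? xs = length (filter P? xs)

  module _ {P : A → Set} (P? : Decidable P) where

    count-∷ : ∀ x xs → count P? (x ∷ xs) ≡ indicator (P? x) + count P? xs
    count-∷ x xs with P? x
    ... | yes _ = refl
    ... | no _ = refl

    count-as-sum : ∀ xs → count P? xs ≡ sum (map (λ x → indicator (P? x)) xs)
    count-as-sum [] = refl
    count-as-sum (x ∷ xs) = trans (count-∷ x xs) (cong (indicator (P? x) +_) (count-as-sum xs))

    count-none : ∀ xs → (∀ x → x ∈ xs → ¬ P x) → count P? xs ≡ 0
    count-none [] _ = refl
    count-none (x ∷ xs) none with P? x
    ... | yes px = ⊥-elim (none x (here refl) px)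
    ... | no _ = count-none xs (λ y y∈ → none y (there y∈))

    count-witness : ∀ xs → 1 ≤ count P? xs → ∃ λ x → x ∈ xs × P x
    count-witness (x ∷ xs) pos with P? x
    ... | yes px = x , here refl , px
    ... | no _ with count-witness xs pos
    ...   | y , y∈ , py = y , there y∈ , py

    count-≤1 : ∀ xs → Unique xs → (∀ x y → x ∈ xs → y ∈ xs → P x → P y → x ≡ y) → count P? xs ≤ 1
    count-≤1 [] _ _ = z≤n
    count-≤1 (x ∷ xs) (x∉ ∷ u) atMostOne with P? x
    ... | yes px = s≤s (≤-reflexive (count-none xs λ y y∈ py →
                    All.lookup x∉ y∈ (atMostOne x y (here refl) (there y∈) px py)))
    ... | no _ = count-≤1 xs u (λ y z y∈ z∈ → atMostOne y z (there y∈) (there z∈))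

  module _ {P Q : A → Set} (P? : Decidable P) (Q? : Decidable Q) where

    count-cong : ∀ xs → (∀ x → x ∈ xs → P x → Q x) → (∀ x → x ∈ xs → Q x → P x) → count P? xs ≡ count Q? xs
    count-cong [] _ _ = refl
    count-cong (x ∷ xs) P⇒Q Q⇒P with P? x | Q? x
    ... | yes _ | yes _ = cong suc (count-cong xs (λ y y∈ → P⇒Q y (there y∈)) (λ y y∈ → Q⇒P y (there y∈)))
    ... | no _ | no _ = count-cong xs (λ y y∈ → P⇒Q y (there y∈)) (λ y y∈ → Q⇒P y (there y∈))
    ... | yes px | no ¬qx = ⊥-elim (¬qx (P⇒Q x (here refl) px))
    ... | no ¬px | yes qx = ⊥-elim (¬px (Q⇒P x (here refl) qx))

    count-one-more : ∀ xs p → Unique xs → p ∈ xs → ¬ Q p → P p →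
      (∀ x → x ∈ xs → P x → Q x ⊎ x ≡ p) → (∀ x → x ∈ xs → Q x → P x) → count P? xs ≡ suc (count Q? xs)
    count-one-more (x ∷ xs) .x (x∉ ∷ _) (here refl) ¬qp pp P⇒Q Q⇒P with P? x | Q? x
    ... | no ¬px | _ = ⊥-elim (¬px pp)
    ... | yes _ | yes qx = ⊥-elim (¬qp qx)
    ... | yes _ | no _ = cong suc (count-cong xs P⇒Q′ (λ y y∈ → Q⇒P y (there y∈)))
      where
        P⇒Q′ : ∀ y → y ∈ xs → P y → Q y
        P⇒Q′ y y∈ py with P⇒Q y (there y∈) py
        ... | inj₁ qy = qy
        ... | inj₂ refl = ⊥-elim (All.lookup x∉ y∈ refl)
    count-one-more (x ∷ xs) p (x∉ ∷ u) (there p∈) ¬qp pp P⇒Q Q⇒P with P? x | Q? x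
    ... | yes _ | yes _ = cong suc rest
      where rest = count-one-more xs p u p∈ ¬qp pp (λ y y∈ → P⇒Q y (there y∈)) (λ y y∈ → Q⇒P y (there y∈))
    ... | no _ | no _ = count-one-more xs p u p∈ ¬qp pp (λ y y∈ → P⇒Q y (there y∈)) (λ y y∈ → Q⇒P y (there y∈))
    ... | no ¬px | yes qx = ⊥-elim (¬px (Q⇒P x (here refl) qx))
    ... | yes px | no ¬qx with P⇒Q x (here refl) px
    ...   | inj₁ qx = ⊥-elim (¬qx qx)
    ...   | inj₂ refl = ⊥-elim (All.lookup x∉ p∈ refl)

    count-filter : ∀ xs → count Q? (filter P? xs) ≡ count (λ x → P? x ×-dec Q? x) xs
    count-filter [] = refl
    count-filter (x ∷ xs) with P? x
    ... | no _ = count-filter xs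
    ... | yes _ with Q? x
    ...   | yes _ = cong suc (count-filter xs)
    ...   | no _ = count-filter xs

  count-concatMap : {P : B → Set} (P? : Decidable P) (g : A → List B) (xs : List A) →
    count P? (concatMap g xs) ≡ sum (map (λ x → count P? (g x)) xs)
  count-concatMap P? g [] = refl
  count-concatMap P? g (x ∷ xs) = begin
    length (filter P? (g x ++ concatMap g xs))
      ≡⟨ cong length (filter-++ P? (g x) (concatMap g xs)) ⟩
    length (filter P? (g x) ++ filter P? (concatMap g xs))
      ≡⟨ length-++ (filter P? (g x)) ⟩
    count P? (g x) + count P? (concatMap g xs)
      ≡⟨ cong (count P? (g x) +_) (count-concatMap P? g xs) ⟩
    count P? (g x) + sum (map (λ x → count P? (g x)) xs) ∎

  count-map : {P : B → Set} (P? : Decidable P) (f : A → B) (xs : List A) → count P? (map f xs) ≡ count (λ x → P? (f x)) xs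
  count-map P? f [] = refl
  count-map P? f (x ∷ xs) with P? (f x)
  ... | yes _ = cong suc (count-map P? f xs)
  ... | no _ = count-map P? f xs

  module _ {f g : A → ℕ} where

    sum-cong : ∀ xs → (∀ x → x ∈ xs → f x ≡ g x) → sum (map f xs) ≡ sum (map g xs)
    sum-cong [] _ = refl
    sum-cong (x ∷ xs) f≡g = cong₂ _+_ (f≡g x (here refl)) (sum-cong xs (λ y y∈ → f≡g y (there y∈)))

    sum-mono : ∀ xs → (∀ x → x ∈ xs → f x ≤ g x) → sum (map f xs) ≤ sum (map g xs)
    sum-mono [] _ = z≤n
    sum-mono (x ∷ xs) f≤g = +-mono-≤ (f≤g x (here refl)) (sum-mono xs (λ y y∈ → f≤g y (there y∈)))

    sum-+ : ∀ xs → sum (map (λ x → f x + g x) xs) ≡ sum (map f xs) + sum (map g xs)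
    sum-+ [] = refl
    sum-+ (x ∷ xs) = begin
      (f x + g x) + sum (map (λ x → f x + g x) xs) ≡⟨ cong (f x + g x +_) (sum-+ xs) ⟩
      (f x + g x) + (F + G)                         ≡⟨ +-assoc (f x) (g x) (F + G) ⟩
      f x + (g x + (F + G))                         ≡⟨ cong (f x +_) (+-assoc (g x) F G) ⟨
      f x + ((g x + F) + G)                         ≡⟨ cong (λ t → f x + (t + G)) (+-comm (g x) F) ⟩
      f x + ((F + g x) + G)                         ≡⟨ cong (f x +_) (+-assoc F (g x) G) ⟩
      f x + (F + (g x + G))                         ≡⟨ +-assoc (f x) F (g x + G) ⟨
      (f x + F) + (g x + G)                         ∎
      where
        F = sum (map f xs)
        G = sum (map g xs)

  sum-zero : {f : A → ℕ} (xs : List A) → (∀ x → x ∈ xs → f x ≡ 0) → sum (map f xs) ≡ 0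
  sum-zero [] _ = refl
  sum-zero (x ∷ xs) f≡0 = cong₂ _+_ (f≡0 x (here refl)) (sum-zero xs (λ y y∈ → f≡0 y (there y∈)))

  sum-lower : {f : A → ℕ} (c : ℕ) (xs : List A) → (∀ x → x ∈ xs → c ≤ f x) → c * length xs ≤ sum (map f xs)
  sum-lower c [] _ = ≤-reflexive (*-zeroʳ c)
  sum-lower {f = f} c (x ∷ xs) c≤f = subst (_≤ f x + sum (map f xs)) (sym (*-suc c (length xs)))
    (+-mono-≤ (c≤f x (here refl)) (sum-lower c xs (λ y y∈ → c≤f y (there y∈))))

  sum-split : {P : A → Set} (P? : Decidable P) (f : A → ℕ) (xs : List A) →
    sum (map f xs) ≡ sum (map f (filter P? xs)) + sum (map f (filter (λ x → ¬? (P? x)) xs))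
  sum-split P? f [] = refl
  sum-split P? f (x ∷ xs) with P? x
  ... | yes _ = trans (cong (f x +_) (sum-split P? f xs)) (sym (+-assoc (f x) _ _))
  ... | no _ = begin
    f x + sum (map f xs)  ≡⟨ cong (f x +_) (sum-split P? f xs) ⟩
    f x + (S + S′)        ≡⟨ +-assoc (f x) S S′ ⟨
    (f x + S) + S′        ≡⟨ cong (_+ S′) (+-comm (f x) S) ⟩
    (S + f x) + S′        ≡⟨ +-assoc S (f x) S′ ⟩
    S + (f x + S′)        ∎
    where
      S = sum (map f (filter P? xs))
      S′ = sum (map f (filter (λ x → ¬? (P? x)) xs))

  count-swap : {R : A → B → Set} (R? : ∀ x y → Dec (R x y)) (xs : List A) (ys : List B) →
    sum (map (λ x → count (R? x) ys) xs) ≡ sum (map (λ y → count (λ x → R? x y) xs) ys)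
  count-swap R? [] ys = sym (sum-zero ys (λ _ _ → refl))
  count-swap R? (x ∷ xs) ys = begin
    count (R? x) ys + sum (map (λ x → count (R? x) ys) xs)
      ≡⟨ cong₂ _+_ (count-as-sum (R? x) ys) (count-swap R? xs ys) ⟩
    sum (map (λ y → indicator (R? x y)) ys) + sum (map (λ y → count (λ x → R? x y) xs) ys)
      ≡⟨ sum-+ ys ⟨
    sum (map (λ y → indicator (R? x y) + count (λ x → R? x y) xs) ys)
      ≡⟨ sum-cong ys (λ y _ → count-∷ (λ x → R? x y) x xs) ⟨
    sum (map (λ y → count (λ x → R? x y) (x ∷ xs)) ys) ∎

  sum-≤1 : (c : A → ℕ) (xs : List A) → Unique xs → (∀ x → x ∈ xs → c x ≤ 1) →
    (∀ x y → x ∈ xs → y ∈ xs → 1 ≤ c x → 1 ≤ c y → x ≡ y) → sum (map c xs) ≤ 1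
  sum-≤1 c [] _ _ _ = z≤n
  sum-≤1 c (x ∷ xs) (x∉ ∷ u) c≤1 atMostOne with c x in cx
  ... | zero = sum-≤1 c xs u (λ y y∈ → c≤1 y (there y∈)) (λ y z y∈ z∈ → atMostOne y z (there y∈) (there z∈))
  ... | suc m = subst (λ t → suc m + t ≤ 1) (sym (sum-zero xs rest-zero))
                  (subst (_≤ 1) (sym (+-identityʳ (suc m))) (subst (_≤ 1) cx (c≤1 x (here refl))))
    where
      rest-zero : ∀ y → y ∈ xs → c y ≡ 0
      rest-zero y y∈ with c y in cy
      ... | zero = refl
      ... | suc _ = ⊥-elim (All.lookup x∉ y∈ (atMostOne x y (here refl) (there y∈)
                      (subst (1 ≤_) (sym cx) (s≤s z≤n)) (subst (1 ≤_) (sym cy) (s≤s z≤n))))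

  sum-upTo-suc : (c : ℕ → ℕ) (N : ℕ) → sum (map c (upTo (suc N))) ≡ sum (map c (upTo N)) + c N
  sum-upTo-suc c N = go c (λ i → i) N
    where
      go : (c f : ℕ → ℕ) (N : ℕ) → sum (map c (applyUpTo f (suc N))) ≡ sum (map c (applyUpTo f N)) + c (f N)
      go c f zero = +-comm (c (f 0)) 0
      go c f (suc N) = trans (cong (c (f 0) +_) (go c (λ i → f (suc i)) N)) (sym (+-assoc (c (f 0)) _ _))

  sum-upTo-vanishing : (c : ℕ → ℕ) (M K : ℕ) → (∀ i → M ≤ i → c i ≡ 0) →
    sum (map c (upTo (K + M))) ≡ sum (map c (upTo M))
  sum-upTo-vanishing c M zero _ = refl
  sum-upTo-vanishing c M (suc K) vanish = begin
    sum (map c (upTo (suc (K + M))))         ≡⟨ sum-upTo-suc c (K + M) ⟩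
    sum (map c (upTo (K + M))) + c (K + M)   ≡⟨ cong₂ _+_ (sum-upTo-vanishing c M K vanish) (vanish (K + M) (m≤n+m M K)) ⟩
    sum (map c (upTo M)) + 0                 ≡⟨ +-identityʳ _ ⟩
    sum (map c (upTo M))                     ∎

  sum-upTo-indicator : ∀ d N → d < N → sum (map (λ e → indicator (e ≟ d)) (upTo N)) ≡ 1
  sum-upTo-indicator d (suc N) d<1+N =
    trans (sum-upTo-suc (λ e → indicator (e ≟ d)) N) (last (m≤n⇒m<n∨m≡n (≤-pred d<1+N)))
    where
      last : d < N ⊎ d ≡ N → sum (map (λ e → indicator (e ≟ d)) (upTo N)) + indicator (N ≟ d) ≡ 1
      last (inj₁ d<N) with N ≟ d
      ... | yes refl = ⊥-elim (<-irrefl refl d<N)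
      ... | no _ = trans (+-identityʳ _) (sum-upTo-indicator d N d<N)
      last (inj₂ refl) with N ≟ N
      ... | no N≢N = ⊥-elim (N≢N refl)
      ... | yes _ = cong (_+ 1) (sum-zero (upTo N) below)
        where
          below : ∀ e → e ∈ upTo N → indicator (e ≟ N) ≡ 0
          below e e∈ with e ≟ N
          ... | yes refl = ⊥-elim (<-irrefl refl (∈-upTo⁻ e∈))
          ... | no _ = refl

  remove : ∀ {z} (ws : List B) → z ∈ ws → List B
  remove (w ∷ ws) (here _) = ws
  remove (w ∷ ws) (there z∈) = w ∷ remove ws z∈

  length-remove : ∀ {z} (ws : List B) (z∈ : z ∈ ws) → length ws ≡ suc (length (remove ws z∈))
  length-remove (w ∷ ws) (here _) = refl
  length-remove (w ∷ ws) (there z∈) = cong suc (length-remove ws z∈)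

  ∈-remove : ∀ {z y} (ws : List B) (z∈ : z ∈ ws) → y ∈ ws → y ≢ z → y ∈ remove ws z∈
  ∈-remove (w ∷ ws) (here refl) (here refl) y≢z = ⊥-elim (y≢z refl)
  ∈-remove (w ∷ ws) (here _) (there y∈) _ = y∈
  ∈-remove (w ∷ ws) (there _) (here y≡w) _ = here y≡w
  ∈-remove (w ∷ ws) (there z∈) (there y∈) y≢z = there (∈-remove ws z∈ y∈ y≢z)

  unique-⊆-length : (zs ws : List B) → Unique zs → (∀ z → z ∈ zs → z ∈ ws) → length zs ≤ length ws
  unique-⊆-length [] ws _ _ = z≤n
  unique-⊆-length (z ∷ zs) ws (z∉ ∷ u) zs⊆ws =
    subst (suc (length zs) ≤_) (sym (length-remove ws z∈ws))
      (s≤s (unique-⊆-length zs (remove ws z∈ws) u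
        (λ y y∈ → ∈-remove ws z∈ws (zs⊆ws y (there y∈)) (λ y≡z → All.lookup z∉ y∈ (sym y≡z)))))
    where z∈ws = zs⊆ws z (here refl)

  module _ {P : A → Set} {Q : B → Set} (P? : Decidable P) (Q? : Decidable Q)
           (φ : ∀ x → P x → B) (φ-Q : ∀ x px → Q (φ x px))
           (φ-injective : ∀ x y px py → φ x px ≡ φ y py → x ≡ y) where

    images : List A → List B
    images [] = []
    images (x ∷ xs) with P? x
    ... | yes px = φ x px ∷ images xs
    ... | no _ = images xs

    length-images : ∀ xs → length (images xs) ≡ count P? xs
    length-images [] = refl
    length-images (x ∷ xs) with P? x
    ... | yes _ = cong suc (length-images xs)
    ... | no _ = length-images xs

    ∈-images : ∀ {z} xs → z ∈ images xs → ∃ λ y → y ∈ xs × Σ (P y) λ py → z ≡ φ y py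
    ∈-images (x ∷ xs) z∈ with P? x
    ∈-images (x ∷ xs) (here z≡) | yes px = x , here refl , px , z≡
    ∈-images (x ∷ xs) (there z∈) | yes _ with ∈-images xs z∈
    ... | y , y∈ , py , z≡ = y , there y∈ , py , z≡
    ∈-images (x ∷ xs) z∈ | no _ with ∈-images xs z∈
    ... | y , y∈ , py , z≡ = y , there y∈ , py , z≡

    images-unique : ∀ xs → Unique xs → Unique (images xs)
    images-unique [] _ = []
    images-unique (x ∷ xs) (x∉ ∷ u) with P? x
    ... | no _ = images-unique xs u
    ... | yes px = All.tabulate fresh ∷ images-unique xs u
      where
        fresh : ∀ {z} → z ∈ images xs → φ x px ≢ z
        fresh z∈ φx≡z with ∈-images xs z∈
        ... | y , y∈ , py , z≡φy = All.lookup x∉ y∈ (φ-injective x y px py (trans φx≡z z≡φy))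

    count-injection : ∀ xs ys → Unique xs → (∀ x px → φ x px ∈ ys) → count P? xs ≤ count Q? ys
    count-injection xs ys u φ∈ys = subst (_≤ count Q? ys) (length-images xs)
      (unique-⊆-length (images xs) (filter Q? ys) (images-unique xs u) image⊆)
      where
        image⊆ : ∀ z → z ∈ images xs → z ∈ filter Q? ys
        image⊆ z z∈ with ∈-images xs z∈
        ... | y , _ , py , refl = ∈-filter⁺ Q? (φ∈ys y py) (φ-Q y py)

-- Lists that differ by trailing
-- zeros denote the same polynomial, so ring laws hold up to the
-- coefficientwise equality _≈_.
module Polynomials {q : ℕ} (F : FiniteField q) where

  open import Level using (0ℓ)
  open import Data.Nat using (zero; suc; _+_; _<_; _⊔_; s≤s; _<?_)
  open import Data.Nat.Properties
    using (<-irrefl; ≤-refl; ≤-reflexive; ≤-trans; <⇒≤; <-cmp; +-suc; m≤m+n; m+n∸m≡n; suc-injective;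
           m≤n⇒m⊔n≡n; ⊔-identityʳ; n≤1+n; m≤n+m; ≤-pred; m+n≤o⇒n≤o; ≮⇒≥)
  open import Data.Fin using (Fin)
  open import Data.Fin.Properties using (_≟_)
  open import Data.Vec using (Vec; []; _∷_; toList)
  open import Data.List using (List; []; _∷_; _++_; map; length)
  open import Data.List.Properties using (length-map)
  open import Data.Empty using (⊥-elim)
  open import Data.Product using (Σ; ∃; _×_; _,_; proj₁; proj₂)
  open import Data.Sum using (inj₁; inj₂)
  open import Relation.Nullary using (¬_; yes; no)
  open import Relation.Binary using (Tri; tri<; tri≈; tri>)
  open import Relation.Binary.PropositionalEquality using (_≡_; _≢_; refl; sym; trans; cong; cong₂; subst; subst₂)
  open import Algebra.Bundles using (CommutativeRing)
  open import Relation.Binary.Bundles using (Setoid)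
  import Relation.Binary.Reasoning.Setoid
  open import Algebra.Structures using (IsCommutativeRing)
  open FiniteField F
  open IsCommutativeRing isCommutativeRing
    using (+-comm; +-identityˡ; +-identityʳ; *-comm; *-assoc; *-identityˡ; *-identityʳ; zeroˡ; zeroʳ; distribˡ; -‿inverseʳ)

  -- F_q as a commutative ring bundle, to reuse the library's derived laws.
  𝔽 : CommutativeRing 0ℓ 0ℓ
  𝔽 = record { isCommutativeRing = isCommutativeRing }

  open import Algebra.Properties.CommutativeSemigroup (CommutativeRing.+-commutativeSemigroup 𝔽)
    using (interchange; x∙yz≈y∙xz; xy∙z≈xz∙y)
  open import Algebra.Properties.Ring (CommutativeRing.ring 𝔽) using (-1*x≈-x)

  Poly : Set
  Poly = List (Fin q)

  add mul : Poly → Poly → Poly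
  add = addL F
  mul = mulL F

  scale : Fin q → Poly → Poly
  scale c a = map (c ⊗_) a

  shift : Poly → Poly
  shift a = 0# ∷ a

  coef : Poly → ℕ → Fin q
  coef [] _ = 0#
  coef (x ∷ xs) zero = x
  coef (x ∷ xs) (suc i) = coef xs i

  infix 4 _≈_
  record _≈_ (a b : Poly) : Set where
    constructor coefwise
    field at : ∀ i → coef a i ≡ coef b i
  open _≈_ public

  ≈-refl : ∀ {a} → a ≈ a
  ≈-refl = coefwise λ _ → refl

  ≈-sym : ∀ {a b} → a ≈ b → b ≈ a
  ≈-sym a≈b = coefwise λ i → sym (at a≈b i)

  ≈-trans : ∀ {a b c} → a ≈ b → b ≈ c → a ≈ c
  ≈-trans a≈b b≈c = coefwise λ i → trans (at a≈b i) (at b≈c i)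

  ≡⇒≈ : ∀ {a b} → a ≡ b → a ≈ b
  ≡⇒≈ refl = ≈-refl

  ≈-setoid : Setoid 0ℓ 0ℓ
  ≈-setoid = record { Carrier = Poly ; _≈_ = _≈_ ; isEquivalence = record { refl = ≈-refl ; sym = ≈-sym ; trans = ≈-trans } }

  module ≈-Reasoning = Relation.Binary.Reasoning.Setoid ≈-setoid

  IsZero : Poly → Set
  IsZero a = a ≈ []

  coef-add : ∀ a b i → coef (add a b) i ≡ coef a i ⊕ coef b i
  coef-add [] b i = sym (+-identityˡ _)
  coef-add (x ∷ a) [] zero = sym (+-identityʳ _)
  coef-add (x ∷ a) [] (suc i) = sym (+-identityʳ _)
  coef-add (x ∷ a) (y ∷ b) zero = refl
  coef-add (x ∷ a) (y ∷ b) (suc i) = coef-add a b i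

  coef-scale : ∀ c a i → coef (scale c a) i ≡ c ⊗ coef a i
  coef-scale c [] i = sym (zeroʳ c)
  coef-scale c (x ∷ a) zero = refl
  coef-scale c (x ∷ a) (suc i) = coef-scale c a i

  coef-beyond : ∀ a i → length a ≤ i → coef a i ≡ 0#
  coef-beyond [] i _ = refl
  coef-beyond (x ∷ a) (suc i) (s≤s ≤i) = coef-beyond a i ≤i

  ∷-cong : ∀ {x y a b} → x ≡ y → a ≈ b → (x ∷ a) ≈ (y ∷ b)
  ∷-cong {x} {y} {a} {b} x≡y a≈b = coefwise coefs
    where
      coefs : ∀ i → coef (x ∷ a) i ≡ coef (y ∷ b) i
      coefs zero = x≡y
      coefs (suc i) = at a≈b i

  ∷-injectiveʳ : ∀ {x y a b} → (x ∷ a) ≈ (y ∷ b) → a ≈ b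
  ∷-injectiveʳ xa≈yb = coefwise λ i → at xa≈yb (suc i)

  zero-∷ : ∀ {x a} → x ≡ 0# → IsZero a → IsZero (x ∷ a)
  zero-∷ {x} {a} x≡0 a≈0 = coefwise coefs
    where
      coefs : ∀ i → coef (x ∷ a) i ≡ coef [] i
      coefs zero = x≡0
      coefs (suc i) = at a≈0 i

  zero-tail : ∀ {x a} → IsZero (x ∷ a) → IsZero a
  zero-tail xa≈0 = coefwise λ i → at xa≈0 (suc i)

  add-cong : ∀ {a a′ b b′} → a ≈ a′ → b ≈ b′ → add a b ≈ add a′ b′
  add-cong {a} {a′} {b} {b′} a≈ b≈ = coefwise λ i →
    trans (coef-add a b i) (trans (cong₂ _⊕_ (at a≈ i) (at b≈ i)) (sym (coef-add a′ b′ i)))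

  scale-cong : ∀ {c a a′} → a ≈ a′ → scale c a ≈ scale c a′
  scale-cong {c} {a} {a′} a≈ = coefwise λ i →
    trans (coef-scale c a i) (trans (cong (c ⊗_) (at a≈ i)) (sym (coef-scale c a′ i)))

  add-comm : ∀ a b → add a b ≈ add b a
  add-comm a b = coefwise λ i → trans (coef-add a b i) (trans (+-comm _ _) (sym (coef-add b a i)))

  add-zeroʳ : ∀ a b → IsZero b → add a b ≈ a
  add-zeroʳ a b b≈0 = coefwise λ i → trans (coef-add a b i) (trans (cong (coef a i ⊕_) (at b≈0 i)) (+-identityʳ _))

  add-interchange : ∀ a b c d → add (add a b) (add c d) ≈ add (add a c) (add b d)
  add-interchange a b c d = coefwise λ i →
    trans (coef-add (add a b) (add c d) i) (trans (cong₂ _⊕_ (coef-add a b i) (coef-add c d i))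
      (trans (interchange _ _ _ _) (sym (trans (coef-add (add a c) (add b d) i) (cong₂ _⊕_ (coef-add a c i) (coef-add b d i))))))

  add-swapʳ : ∀ a b c → add (add a b) c ≈ add (add a c) b
  add-swapʳ a b c = coefwise λ i →
    trans (coef-add (add a b) c i) (trans (cong (_⊕ coef c i) (coef-add a b i))
      (trans (xy∙z≈xz∙y _ _ _) (sym (trans (coef-add (add a c) b i) (cong (_⊕ coef b i) (coef-add a c i))))))

  shift-add : ∀ a b → shift (add a b) ≈ add (shift a) (shift b)
  shift-add a b = ∷-cong (sym (+-identityʳ _)) ≈-refl

  scale-add : ∀ c a b → scale c (add a b) ≈ add (scale c a) (scale c b)
  scale-add c a b = coefwise λ i →
    trans (coef-scale c (add a b) i) (trans (cong (c ⊗_) (coef-add a b i)) (trans (distribˡ c _ _)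
      (sym (trans (coef-add (scale c a) (scale c b) i) (cong₂ _⊕_ (coef-scale c a i) (coef-scale c b i))))))

  scale-scale : ∀ c x b → scale (c ⊗ x) b ≈ scale c (scale x b)
  scale-scale c x b = coefwise λ i →
    trans (coef-scale (c ⊗ x) b i) (trans (*-assoc c x _) (sym (trans (coef-scale c (scale x b) i) (cong (c ⊗_) (coef-scale x b i)))))

  scale-shift : ∀ c a → scale c (shift a) ≈ shift (scale c a)
  scale-shift c a = ∷-cong (zeroʳ c) ≈-refl

  mul-zeroˡ : ∀ a b → IsZero a → IsZero (mul a b)
  mul-zeroˡ [] b _ = ≈-refl
  mul-zeroˡ (x ∷ a) b xa≈0 = coefwise λ i →
    trans (coef-add (scale x b) (shift (mul a b)) i)
      (trans (cong₂ _⊕_ (trans (coef-scale x b i) (trans (cong (_⊗ coef b i) (at xa≈0 zero)) (zeroˡ _))) (shifted i))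
        (+-identityʳ _))
    where
      shifted : ∀ i → coef (shift (mul a b)) i ≡ 0#
      shifted zero = refl
      shifted (suc i) = at (mul-zeroˡ a b (zero-tail xa≈0)) i

  mul-zeroʳ : ∀ a → IsZero (mul a [])
  mul-zeroʳ [] = ≈-refl
  mul-zeroʳ (x ∷ a) = zero-∷ refl (mul-zeroʳ a)

  mul-congˡ : ∀ {a a′} b → a ≈ a′ → mul a b ≈ mul a′ b
  mul-congˡ {[]} {[]} b _ = ≈-refl
  mul-congˡ {[]} {y ∷ a′} b a≈ = ≈-sym (mul-zeroˡ (y ∷ a′) b (≈-sym a≈))
  mul-congˡ {x ∷ a} {[]} b a≈ = mul-zeroˡ (x ∷ a) b a≈
  mul-congˡ {x ∷ a} {y ∷ a′} b a≈ =
    add-cong (coefwise λ i → trans (coef-scale x b i) (trans (cong (_⊗ coef b i) (at a≈ zero)) (sym (coef-scale y b i))))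
             (∷-cong refl (mul-congˡ b (∷-injectiveʳ a≈)))

  mul-congʳ : ∀ a {b b′} → b ≈ b′ → mul a b ≈ mul a b′
  mul-congʳ [] _ = ≈-refl
  mul-congʳ (x ∷ a) b≈ = add-cong (scale-cong b≈) (∷-cong refl (mul-congʳ a b≈))

  mul-∷ʳ : ∀ a y b → mul a (y ∷ b) ≈ add (scale y a) (shift (mul a b))
  mul-∷ʳ [] y b = ≈-sym (zero-∷ refl ≈-refl)
  mul-∷ʳ (x ∷ a) y b = ∷-cong (cong (_⊕ 0#) (*-comm x y)) (coefwise λ i →
    trans (coef-add (scale x b) (mul a (y ∷ b)) i)
    (trans (cong (coef (scale x b) i ⊕_) (trans (at (mul-∷ʳ a y b) i) (coef-add (scale y a) (shift (mul a b)) i)))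
    (trans (x∙yz≈y∙xz _ _ _)
    (trans (cong (coef (scale y a) i ⊕_) (sym (coef-add (scale x b) (shift (mul a b)) i)))
    (sym (coef-add (scale y a) (mul (x ∷ a) b) i))))))

  mul-comm : ∀ a b → mul a b ≈ mul b a
  mul-comm [] b = ≈-sym (mul-zeroʳ b)
  mul-comm (x ∷ a) b = ≈-trans (add-cong ≈-refl (∷-cong refl (mul-comm a b))) (≈-sym (mul-∷ʳ b x a))

  mul-distribˡ : ∀ a b c → mul a (add b c) ≈ add (mul a b) (mul a c)
  mul-distribˡ [] b c = ≈-refl
  mul-distribˡ (x ∷ a) b c =
    ≈-trans (add-cong (scale-add x b c) (≈-trans (∷-cong refl (mul-distribˡ a b c)) (shift-add (mul a b) (mul a c))))
            (add-interchange (scale x b) (scale x c) (shift (mul a b)) (shift (mul a c)))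

  mul-distribʳ : ∀ a b c → mul (add a b) c ≈ add (mul a c) (mul b c)
  mul-distribʳ a b c =
    ≈-trans (mul-comm (add a b) c) (≈-trans (mul-distribˡ c a b) (add-cong (mul-comm c a) (mul-comm c b)))

  mul-scaleˡ : ∀ c a b → mul (scale c a) b ≈ scale c (mul a b)
  mul-scaleˡ c [] b = ≈-refl
  mul-scaleˡ c (x ∷ a) b =
    ≈-trans (add-cong (scale-scale c x b) (≈-trans (∷-cong refl (mul-scaleˡ c a b)) (≈-sym (scale-shift c (mul a b)))))
            (≈-sym (scale-add c (scale x b) (shift (mul a b))))

  mul-shiftˡ : ∀ a c → mul (shift a) c ≈ shift (mul a c)
  mul-shiftˡ a c = coefwise λ i →
    trans (coef-add (scale 0# c) (shift (mul a c)) i)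
      (trans (cong (_⊕ coef (shift (mul a c)) i) (trans (coef-scale 0# c i) (zeroˡ _))) (+-identityˡ _))

  mul-assoc : ∀ a b c → mul (mul a b) c ≈ mul a (mul b c)
  mul-assoc [] b c = ≈-refl
  mul-assoc (x ∷ a) b c =
    ≈-trans (mul-distribʳ (scale x b) (shift (mul a b)) c)
            (add-cong (mul-scaleˡ x b c) (≈-trans (mul-shiftˡ (mul a b) c) (∷-cong refl (mul-assoc a b c))))

  coef-const0 : ∀ i → coef (0# ∷ []) i ≡ 0#
  coef-const0 zero = refl
  coef-const0 (suc i) = refl

  scale-as-mul : ∀ c a → scale c a ≈ mul (c ∷ []) a
  scale-as-mul c a = coefwise λ i →
    sym (trans (coef-add (scale c a) (0# ∷ []) i) (trans (cong (coef (scale c a) i ⊕_) (coef-const0 i)) (+-identityʳ _)))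

  mul-oneˡ : ∀ b → mul (1# ∷ []) b ≈ b
  mul-oneˡ b = ≈-trans (≈-sym (scale-as-mul 1# b)) (coefwise λ i → trans (coef-scale 1# b i) (*-identityˡ _))

  mul-oneʳ : ∀ b → mul b (1# ∷ []) ≈ b
  mul-oneʳ b = ≈-trans (mul-comm b _) (mul-oneˡ b)

  subtract : ∀ x y z → x ≈ add y z → z ≈ add x (scale (⊖ 1#) y)
  subtract x y z x≈y+z = coefwise λ i → sym (begin
    coef (add x (scale (⊖ 1#) y)) i       ≡⟨ coef-add x (scale (⊖ 1#) y) i ⟩
    coef x i ⊕ coef (scale (⊖ 1#) y) i     ≡⟨ cong₂ _⊕_ (trans (at x≈y+z i) (coef-add y z i))
                                                         (trans (coef-scale (⊖ 1#) y i) (-1*x≈-x _)) ⟩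
    (coef y i ⊕ coef z i) ⊕ ⊖ coef y i     ≡⟨ xy∙z≈xz∙y _ _ _ ⟩
    (coef y i ⊕ ⊖ coef y i) ⊕ coef z i     ≡⟨ cong (_⊕ coef z i) (-‿inverseʳ _) ⟩
    0# ⊕ coef z i                          ≡⟨ +-identityˡ _ ⟩
    coef z i                               ∎)
    where open Relation.Binary.PropositionalEquality.≡-Reasoning

  1≢0 : 1# ≢ 0#
  1≢0 1≡0 = 0≢1 (sym 1≡0)

  infix 4 _∣_
  record _∣_ (g a : Poly) : Set where
    constructor divides
    field
      quotient : Poly
      equation : mul g quotient ≈ a

  ∣-resp-≈ : ∀ {g a b} → g ∣ a → a ≈ b → g ∣ b
  ∣-resp-≈ (divides h gh≈a) a≈b = divides h (≈-trans gh≈a a≈b)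

  ∣-mul : ∀ g b → g ∣ mul g b
  ∣-mul g b = divides b ≈-refl

  ∣-add : ∀ {g a b} → g ∣ a → g ∣ b → g ∣ add a b
  ∣-add {g} (divides h gh≈a) (divides k gk≈b) = divides (add h k) (≈-trans (mul-distribˡ g h k) (add-cong gh≈a gk≈b))

  ∣-mulˡ : ∀ {g a} b → g ∣ a → g ∣ mul b a
  ∣-mulˡ {g} {a} b (divides h gh≈a) = divides (mul b h) (begin
    mul g (mul b h)  ≈⟨ mul-assoc g b h ⟨
    mul (mul g b) h  ≈⟨ mul-congˡ h (mul-comm g b) ⟩
    mul (mul b g) h  ≈⟨ mul-assoc b g h ⟩
    mul b (mul g h)  ≈⟨ mul-congʳ b gh≈a ⟩
    mul b a          ∎)
    where open ≈-Reasoning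

  ∣-scale : ∀ {g a} c → g ∣ a → g ∣ scale c a
  ∣-scale {g} {a} c g∣a = ∣-resp-≈ (∣-mulˡ (c ∷ []) g∣a) (≈-sym (scale-as-mul c a))

  ∣-difference : ∀ {g a s t} → a ≈ add s t → g ∣ a → g ∣ s → g ∣ t
  ∣-difference {a = a} {s} {t} a≈s+t g∣a g∣s =
    ∣-resp-≈ (∣-add g∣a (∣-scale (⊖ 1#) g∣s)) (≈-sym (subtract a s t a≈s+t))

  ∣-remainder : ∀ {g a m s t} b → a ≈ add (mul m s) t → g ∣ mul a b → g ∣ mul m b → g ∣ mul t b
  ∣-remainder {m = m} {s} {t} b a≈ms+t g∣ab g∣mb = ∣-difference
    (≈-trans (mul-congˡ b a≈ms+t) (mul-distribʳ (mul m s) t b)) g∣ab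
    (∣-resp-≈ (∣-mulˡ s g∣mb) (≈-trans (≈-sym (mul-assoc s m b)) (mul-congˡ b (mul-comm s m))))

  ∣-zero-remainder : ∀ {a m s t} → a ≈ add (mul m s) t → IsZero t → m ∣ a
  ∣-zero-remainder {m = m} {s} {t} a≈ms+t t≈0 = divides s (≈-sym (≈-trans a≈ms+t (add-zeroʳ (mul m s) t t≈0)))

  prefix : (ℕ → Fin q) → (j : ℕ) → Vec (Fin q) j
  prefix g zero = []
  prefix g (suc j) = g 0 ∷ prefix (λ i → g (suc i)) j

  coef-prefix : ∀ g j i → i < j → coef (toList (prefix g j)) i ≡ g i
  coef-prefix g (suc j) zero _ = refl
  coef-prefix g (suc j) (suc i) (s≤s i<j) = coef-prefix (λ i → g (suc i)) j i i<j

  prefix-zero : ∀ j → IsZero (toList (prefix (λ _ → 0#) j))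
  prefix-zero zero = ≈-refl
  prefix-zero (suc j) = zero-∷ refl (prefix-zero j)

  length-toList : ∀ {j} (v : Vec (Fin q) j) → length (toList v) ≡ j
  length-toList [] = refl
  length-toList (x ∷ v) = cong suc (length-toList v)

  coef-snoc-below : ∀ {j} (v : Vec (Fin q) j) y i → i < j → coef (toList v ++ y ∷ []) i ≡ coef (toList v) i
  coef-snoc-below (x ∷ v) y zero _ = refl
  coef-snoc-below (x ∷ v) y (suc i) (s≤s i<j) = coef-snoc-below v y i i<j

  coef-snoc-top : ∀ {j} (v : Vec (Fin q) j) y → coef (toList v ++ y ∷ []) j ≡ y
  coef-snoc-top [] y = refl
  coef-snoc-top (x ∷ v) y = coef-snoc-top v y

  coef-snoc-above : ∀ {j} (v : Vec (Fin q) j) y i → j < i → coef (toList v ++ y ∷ []) i ≡ 0#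
  coef-snoc-above [] y (suc i) _ = refl
  coef-snoc-above (x ∷ v) y (suc i) (s≤s j<i) = coef-snoc-above v y i j<i

  length-snoc : ∀ {j} (v : Vec (Fin q) j) y → length (toList v ++ y ∷ []) ≡ suc j
  length-snoc [] y = refl
  length-snoc (x ∷ v) y = cong suc (length-snoc v y)

  trim : ∀ a j → (∀ i → j < i → coef a i ≡ 0#) → toList (prefix (coef a) j) ++ coef a j ∷ [] ≈ a
  trim a j above = coefwise λ i → compare i (<-cmp i j)
    where
      v = prefix (coef a) j
      compare : ∀ i → Tri (i < j) (i ≡ j) (j < i) → coef (toList v ++ coef a j ∷ []) i ≡ coef a i
      compare i (tri< i<j _ _) = trans (coef-snoc-below v _ i i<j) (coef-prefix (coef a) j i i<j)
      compare i (tri≈ _ refl _) = coef-snoc-top v _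
      compare i (tri> _ _ j<i) = trans (coef-snoc-above v _ i j<i) (sym (above i j<i))

  ≈-length⇒≡ : ∀ a b → a ≈ b → length a ≡ length b → a ≡ b
  ≈-length⇒≡ [] [] _ _ = refl
  ≈-length⇒≡ (x ∷ a) (y ∷ b) a≈b la≡lb =
    cong₂ _∷_ (at a≈b zero) (≈-length⇒≡ a b (∷-injectiveʳ a≈b) (suc-injective la≡lb))

  length-add : ∀ a b → length (add a b) ≡ length a ⊔ length b
  length-add [] b = refl
  length-add (x ∷ a) [] = refl
  length-add (x ∷ a) (y ∷ b) = cong suc (length-add a b)

  length-mul : ∀ a b i j → length a ≡ suc i → length b ≡ suc j → length (mul a b) ≡ suc (i + j)
  length-mul (x ∷ []) (y ∷ b) i j refl refl =
    cong suc (trans (length-add (scale x b) []) (trans (⊔-identityʳ _) (length-map _ b)))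
  length-mul (x ∷ x′ ∷ a) (y ∷ b) i j refl refl = cong suc (begin
    length (add (scale x b) (mul (x′ ∷ a) (y ∷ b)))
      ≡⟨ length-add (scale x b) (mul (x′ ∷ a) (y ∷ b)) ⟩
    length (scale x b) ⊔ length (mul (x′ ∷ a) (y ∷ b))
      ≡⟨ cong₂ _⊔_ (length-map _ b) (length-mul (x′ ∷ a) (y ∷ b) (length a) (length b) refl refl) ⟩
    length b ⊔ suc (length a + length b)
      ≡⟨ m≤n⇒m⊔n≡n (≤-trans (m≤n+m (length b) (length a)) (n≤1+n _)) ⟩
    suc (length a + length b) ∎)
    where open Relation.Binary.PropositionalEquality.≡-Reasoning

  coef-mul-above : ∀ a b i → length a + length b ≤ suc i → coef (mul a b) i ≡ 0#
  coef-mul-above [] b i _ = refl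
  coef-mul-above (x ∷ a) b i la+lb≤ = trans (coef-add (scale x b) (shift (mul a b)) i)
    (trans (cong₂ _⊕_ scaled (shifted i la+lb≤)) (+-identityʳ _))
    where
      scaled : coef (scale x b) i ≡ 0#
      scaled = trans (coef-scale x b i)
        (trans (cong (x ⊗_) (coef-beyond b i (m+n≤o⇒n≤o (length a) (≤-pred la+lb≤)))) (zeroʳ x))
      shifted : ∀ i → suc (length a + length b) ≤ suc i → coef (shift (mul a b)) i ≡ 0#
      shifted zero _ = refl
      shifted (suc i) ≤i = coef-mul-above a b i (≤-pred ≤i)

  coef-mul-top : ∀ a b i j → length a ≡ suc i → length b ≡ suc j → coef (mul a b) (i + j) ≡ coef a i ⊗ coef b j
  coef-mul-top (x ∷ []) b i j refl lb =
    trans (coef-add (scale x b) (0# ∷ []) j) (trans (cong₂ _⊕_ (coef-scale x b j) (coef-const0 j)) (+-identityʳ _))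
  coef-mul-top (x ∷ x′ ∷ a) b i j refl lb =
    trans (coef-add (scale x b) (shift (mul (x′ ∷ a) b)) (suc (length a + j)))
      (trans (cong₂ _⊕_ scaled (coef-mul-top (x′ ∷ a) b (length a) j refl lb)) (+-identityˡ _))
    where
      scaled : coef (scale x b) (suc (length a + j)) ≡ 0#
      scaled = trans (coef-scale x b _)
        (trans (cong (x ⊗_) (coef-beyond b _ (subst (_≤ suc (length a + j)) (sym lb) (s≤s (m≤n+m j (length a)))))) (zeroʳ x))

  data Leading (a : Poly) : Set where
    zeroPoly : IsZero a → Leading a
    leadingAt : (j : ℕ) → coef a j ≢ 0# → (∀ i → j < i → coef a i ≡ 0#) → Leading a

  leading : ∀ a → Leading a
  leading [] = zeroPoly ≈-refl
  leading (x ∷ a) with leading a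
  ... | leadingAt j cj≢0 above = leadingAt (suc j) cj≢0 λ { (suc i) (s≤s j<i) → above i j<i }
  ... | zeroPoly a≈0 with x ≟ 0#
  ...   | yes x≡0 = zeroPoly (zero-∷ x≡0 a≈0)
  ...   | no x≢0 = leadingAt 0 x≢0 λ { (suc i) _ → at a≈0 i }

  nonzero : ∀ {a} j → coef a j ≢ 0# → ¬ IsZero a
  nonzero j cj≢0 a≈0 = cj≢0 (at a≈0 j)

  leading-below-length : ∀ a j → coef a j ≢ 0# → j < length a
  leading-below-length a j cj≢0 with j <? length a
  ... | yes j<len = j<len
  ... | no j≮len = ⊥-elim (cj≢0 (coef-beyond a j (≮⇒≥ j≮len)))

  leading-unique : ∀ a j k → coef a j ≢ 0# → (∀ i → j < i → coef a i ≡ 0#) →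
                   coef a k ≢ 0# → (∀ i → k < i → coef a i ≡ 0#) → j ≡ k
  leading-unique a j k cj≢0 aboveJ ck≢0 aboveK with <-cmp j k
  ... | tri< j<k _ _ = ⊥-elim (ck≢0 (aboveJ k j<k))
  ... | tri≈ _ j≡k _ = j≡k
  ... | tri> _ _ k<j = ⊥-elim (cj≢0 (aboveK j k<j))

  IsMonic : ℕ → Poly → Set
  IsMonic e g = length g ≡ suc e × coef g e ≡ 1#

  full-monic : ∀ {j} (v : Vec (Fin q) j) → IsMonic j (full F v)
  full-monic v = length-snoc v 1# , coef-snoc-top v 1#

  square-monic : ∀ {j} (v : Vec (Fin q) j) → IsMonic (j + j) (mul (full F v) (full F v))
  square-monic {j} v = length-mul V V j j lv lv , trans (coef-mul-top V V j j lv lv) (trans (cong₂ _⊗_ tv tv) (*-identityˡ 1#))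
    where
      V = full F v
      lv = proj₁ (full-monic v)
      tv = proj₂ (full-monic v)

  Divides⇒∣ : ∀ {m} e g (f : Vec (Fin q) m) → Divides F e g f → g ∣ full F f
  Divides⇒∣ e g f (_ , h , gh≡f) = divides (full F h) (≡⇒≈ gh≡f)

  Divides-intro : ∀ {m} e j g (f : Vec (Fin q) m) → m ≡ e + j →
    (h : Vec (Fin q) j) → mul g (full F h) ≡ full F f → Divides F e g f
  Divides-intro e j g f refl h gh≡f =
    m≤m+n e j , subst (λ k → Σ (Vec (Fin q) k) λ h → mul g (full F h) ≡ full F f) (sym (m+n∸m≡n e j)) (h , gh≡f)

  -- If a monic g of degree e times h (with top coefficient c ≠ 0 at j) is
  -- the monic f of degree m, then e + j = m and c = 1, so g divides f in
  -- the exact sense of Defs.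
  Divides-from-product : ∀ {m e j g} → IsMonic e g → (f : Vec (Fin q) m) (v : Vec (Fin q) j) (c : Fin q) → c ≢ 0# →
    mul g (toList v ++ c ∷ []) ≈ full F f → Divides F e g f
  Divides-from-product {m} {e} {j} {g} (lg , tg) f v c c≢0 gH≈f =
    Divides-intro e j g f (sym e+j≡m) v (≈-length⇒≡ _ _ gv≈f lengths)
    where
      H = toList v ++ c ∷ []
      top : coef (mul g H) (e + j) ≡ c
      top = trans (coef-mul-top g H e j lg (length-snoc v c)) (trans (cong₂ _⊗_ tg (coef-snoc-top v c)) (*-identityˡ c))
      above : ∀ i → e + j < i → coef (mul g H) i ≡ 0#
      above i e+j<i = coef-mul-above g H i (subst₂ (λ s t → s + t ≤ suc i) (sym lg) (sym (length-snoc v c))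
                        (s≤s (subst (_≤ i) (sym (+-suc e j)) e+j<i)))
      e+j≡m : e + j ≡ m
      e+j≡m = leading-unique (mul g H) (e + j) m (λ ctop≡0 → c≢0 (trans (sym top) ctop≡0)) above
        (λ cm≡0 → 1≢0 (trans (sym (coef-snoc-top f 1#)) (trans (sym (at gH≈f m)) cm≡0)))
        (λ i m<i → trans (at gH≈f i) (coef-snoc-above f 1# i m<i))
      c≡1 : c ≡ 1#
      c≡1 = trans (sym top) (trans (at gH≈f (e + j)) (trans (cong (coef (full F f)) e+j≡m) (coef-snoc-top f 1#)))
      gv≈f : mul g (full F v) ≈ full F f
      gv≈f = ≈-trans (mul-congʳ g (≡⇒≈ (cong (λ t → toList v ++ t ∷ []) (sym c≡1)))) gH≈f
      lengths : length (mul g (full F v)) ≡ length (full F f)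
      lengths = trans (length-mul g (full F v) e j lg (length-snoc v 1#)) (trans (cong suc e+j≡m) (sym (length-snoc f 1#)))

  ∣⇒Divides : ∀ {m e} g → IsMonic e g → (f : Vec (Fin q) m) → g ∣ full F f → Divides F e g f
  ∣⇒Divides {m} {e} g g-monic f (divides h gh≈f) with leading h
  ... | zeroPoly h≈0 = ⊥-elim (1≢0 (trans (sym (coef-snoc-top f 1#))
                          (trans (sym (at gh≈f m)) (at (≈-trans (mul-congʳ g h≈0) (mul-zeroʳ g)) m))))
  ... | leadingAt j cj≢0 above = Divides-from-product {g = g} g-monic f (prefix (coef h) j) (coef h j) cj≢0
                                   (≈-trans (mul-congʳ g (trim h j above)) gh≈f)

  monic-associate : ∀ a j → coef a j ≢ 0# → (∀ i → j < i → coef a i ≡ 0#) →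
    ∃ λ c → Σ (Vec (Fin q) j) λ v → full F v ≈ scale c a
  monic-associate a j cj≢0 above = c⁻¹ , prefix (coef (scale c⁻¹ a)) j ,
    ≈-trans (≡⇒≈ (cong (λ t → toList (prefix (coef (scale c⁻¹ a)) j) ++ t ∷ []) (sym top≡1)))
            (trim (scale c⁻¹ a) j above′)
    where
      c⁻¹ = proj₁ (inverse (coef a j) cj≢0)
      top≡1 : coef (scale c⁻¹ a) j ≡ 1#
      top≡1 = trans (coef-scale c⁻¹ a j) (trans (*-comm c⁻¹ _) (proj₂ (inverse (coef a j) cj≢0)))
      above′ : ∀ i → j < i → coef (scale c⁻¹ a) i ≡ 0#
      above′ i j<i = trans (coef-scale c⁻¹ a i) (trans (cong (c⁻¹ ⊗_) (above i j<i)) (zeroʳ c⁻¹))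

  module Division {d : ℕ} (mv : Vec (Fin q) d) where

    M : Poly
    M = full F mv

    -- One step of long division: u of length ≤ d + 1 is c·M plus a
    -- remainder of length d, where c = coef u d.
    reduce : Poly → Vec (Fin q) d
    reduce u = prefix (λ i → coef u i ⊕ ⊖ (coef u d ⊗ coef M i)) d

    reduce-spec : ∀ u → length u ≤ suc d → u ≈ add (scale (coef u d) M) (toList (reduce u))
    reduce-spec u lu = coefwise λ i → trans (compare i (<-cmp i d))
        (sym (trans (coef-add (scale c M) W i) (cong (_⊕ coef W i) (coef-scale c M i))))
      where
        c = coef u d
        W = toList (reduce u)
        W-short : ∀ i → d ≤ i → coef W i ≡ 0#
        W-short i d≤i = coef-beyond W i (subst (_≤ i) (sym (length-toList (reduce u))) d≤i)
        cancel : ∀ x y → x ≡ y ⊕ (x ⊕ ⊖ y)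
        cancel x y = sym (trans (x∙yz≈y∙xz y x (⊖ y)) (trans (cong (x ⊕_) (-‿inverseʳ y)) (+-identityʳ x)))
        compare : ∀ i → Tri (i < d) (i ≡ d) (d < i) → coef u i ≡ c ⊗ coef M i ⊕ coef W i
        compare i (tri< i<d _ _) = trans (cancel (coef u i) (c ⊗ coef M i)) (cong (c ⊗ coef M i ⊕_) (sym (coef-prefix _ d i i<d)))
        compare i (tri≈ _ refl _) = sym (trans (cong₂ _⊕_ (cong (c ⊗_) (coef-snoc-top mv 1#)) (W-short i ≤-refl))
                                       (trans (+-identityʳ _) (*-identityʳ c)))
        compare i (tri> _ _ d<i) = trans (coef-beyond u i (≤-trans lu d<i))
          (sym (trans (cong₂ _⊕_ (cong (c ⊗_) (coef-snoc-above mv 1# i d<i)) (W-short i (<⇒≤ d<i)))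
                 (trans (+-identityʳ _) (zeroʳ c))))

    -- Long division, consuming the coefficients from the top down.
    divMod : Poly → Poly × Vec (Fin q) d
    divMod [] = [] , prefix (λ _ → 0#) d
    divMod (x ∷ a) = coef (x ∷ toList (proj₂ (divMod a))) d ∷ proj₁ (divMod a) , reduce (x ∷ toList (proj₂ (divMod a)))

    quotient : Poly → Poly
    quotient a = proj₁ (divMod a)

    remainder : Poly → Poly
    remainder a = toList (proj₂ (divMod a))

    remainder-length : ∀ a → length (remainder a) ≡ d
    remainder-length a = length-toList (proj₂ (divMod a))

    divMod-spec : ∀ a → a ≈ add (mul M (quotient a)) (remainder a)
    divMod-spec [] = ≈-sym (≈-trans (add-zeroʳ (mul M []) _ (prefix-zero d)) (mul-zeroʳ M))
    divMod-spec (x ∷ a) = begin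
      x ∷ a                                       ≈⟨ ∷-cong refl (divMod-spec a) ⟩
      x ∷ add A T                                 ≈⟨ ∷-cong (sym (+-identityʳ x)) (add-comm A T) ⟩
      add u (shift A)                             ≈⟨ add-cong (reduce-spec u u-short) ≈-refl ⟩
      add (add (scale c M) W) (shift A)           ≈⟨ add-swapʳ (scale c M) W (shift A) ⟩
      add (add (scale c M) (shift A)) W           ≈⟨ add-cong (mul-∷ʳ M c s) ≈-refl ⟨
      add (mul M (c ∷ s)) W                       ∎
      where
        open ≈-Reasoning
        s = proj₁ (divMod a)
        T = toList (proj₂ (divMod a))
        A = mul M s
        u = x ∷ T
        c = coef u d
        W = toList (reduce u)
        u-short : length u ≤ suc d
        u-short = s≤s (≤-reflexive (length-toList (proj₂ (divMod a))))

  module Euclid {e : ℕ} (r : Vec (Fin q) e) (r-irreducible : Irreducible F r) where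

    R : Poly
    R = full F r

    -- Induction on
    -- the degree of a (bounded by the fuel n): normalise a to a monic M of
    -- the same degree; if deg M = 0 we are done, otherwise the remainder T
    -- of R by M is nonzero (R is irreducible) and R ∣ T·b with deg T < deg M.
    mutual
      cancel-coprime : ∀ n a b → length a ≤ n → length a ≤ e → ¬ IsZero a → R ∣ mul a b → R ∣ b
      cancel-coprime zero [] b _ _ a≢0 _ = ⊥-elim (a≢0 ≈-refl)
      cancel-coprime (suc n) a b la≤n la≤e a≢0 R∣ab with leading a
      ... | zeroPoly a≈0 = ⊥-elim (a≢0 a≈0)
      ... | leadingAt j cj≢0 above with monic-associate a j cj≢0 above
      ...   | c , v , M≈ca = cancel-monic n v b (≤-pred (≤-trans j<la la≤n)) (≤-trans j<la la≤e)
                (∣-resp-≈ (∣-scale c R∣ab) (≈-trans (≈-sym (mul-scaleˡ c a b)) (mul-congˡ b (≈-sym M≈ca))))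
        where j<la = leading-below-length a j cj≢0

      cancel-monic : ∀ n {j} (v : Vec (Fin q) j) b → j ≤ n → j < e → R ∣ mul (full F v) b → R ∣ b
      cancel-monic n [] b _ _ R∣1b = ∣-resp-≈ R∣1b (mul-oneˡ b)
      cancel-monic n {suc j} v b deg≤n deg<e R∣Mb = by-remainder (leading (remainder R))
        where
          open Division v
          by-remainder : Leading (remainder R) → R ∣ b
          by-remainder (zeroPoly T≈0) with proj₂ r-irreducible (suc j) v
                                             (∣⇒Divides M (full-monic v) r (∣-zero-remainder {m = M} (divMod-spec R) T≈0))
          ... | inj₁ ()
          ... | inj₂ deg≡e = ⊥-elim (<-irrefl deg≡e deg<e)
          by-remainder (leadingAt i ci≢0 _) =
            cancel-coprime n (remainder R) b
              (subst (_≤ n) (sym (remainder-length R)) deg≤n) (subst (_≤ e) (sym (remainder-length R)) (<⇒≤ deg<e))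
              (nonzero i ci≢0) (∣-remainder {m = M} {t = remainder R} b (divMod-spec R) (∣-mul R b) R∣Mb)

    -- Euclid's lemma: if R ∤ p and R ∣ p·g then R ∣ g.  The remainder T of
    -- p by R is nonzero, of degree below e, and R ∣ T·g.
    euclid : ∀ {d m} (p : Vec (Fin q) d) (g : Vec (Fin q) m) → ¬ Divides F e R p →
      R ∣ mul (full F p) (full F g) → Divides F e R g
    euclid p g R∤p R∣pg = by-remainder (leading (remainder P))
      where
        open Division r
        P = full F p
        by-remainder : Leading (remainder P) → Divides F e R g
        by-remainder (zeroPoly T≈0) =
          ⊥-elim (R∤p (∣⇒Divides R (full-monic r) p (∣-zero-remainder {m = R} (divMod-spec P) T≈0)))
        by-remainder (leadingAt i ci≢0 _) = ∣⇒Divides R (full-monic r) g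
          (cancel-coprime (length (remainder P)) (remainder P) (full F g) ≤-refl (≤-reflexive (remainder-length P))
            (nonzero i ci≢0) (∣-remainder {m = R} {t = remainder P} (full F g) (divMod-spec P) R∣pg (∣-mul R (full F g))))

module Factorisation {q : ℕ} (F : FiniteField q) where

  open import Data.Nat using (zero; suc; _+_; _<_; _≟_; s≤s)
  open import Data.Nat.Properties using (≤-trans; +-comm; +-identityʳ; +-suc; +-monoʳ-≤; m+[n∸m]≡n; n∸n≡0; <-irrefl)
  open import Data.Fin using (Fin)
  import Data.Fin.Properties as FinP
  open import Data.Vec using (Vec; []; _∷_; toList)
  import Data.Vec.Properties as VecP
  open import Data.List using (List; []; _∷_; _++_; map; upTo)
  import Data.List.Properties as ListP
  open import Data.Nat.ListAction using (sum)
  open import Data.List.Membership.Propositional using (_∈_)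
  open import Data.List.Membership.Propositional.Properties using (∈-concatMap⁺; ∈-map⁺; ∈-map⁻; ∈-allFin)
  open import Data.List.Relation.Unary.Any as Any using (here)
  open import Data.List.Relation.Unary.All as All using ([])
  import Data.List.Relation.Unary.All.Properties as AllP
  open import Data.List.Relation.Unary.AllPairs as AllPairs using ([]; _∷_)
  import Data.List.Relation.Unary.AllPairs.Properties as AllPairsP
  open import Data.List.Relation.Unary.Unique.Propositional using (Unique)
  import Data.List.Relation.Unary.Unique.Propositional.Properties as UniqueP
  open import Data.Product using (_×_; _,_; proj₁)
  open import Data.Sum using (_⊎_; inj₁; inj₂)
  open import Relation.Nullary using (yes; no; ¬_)
  open import Relation.Nullary.Decidable using (_×-dec_)
  open import Relation.Binary.PropositionalEquality using (_≡_; _≢_; refl; sym; trans; cong; cong₂; subst)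
  open Relation.Binary.PropositionalEquality.≡-Reasoning
  open FiniteField F using (1#)
  open Counting
  open Polynomials F

  allMonic-complete : ∀ d (v : Vec (Fin q) d) → v ∈ allMonic F d
  allMonic-complete zero [] = here refl
  allMonic-complete (suc d) (x ∷ v) = ∈-concatMap⁺ (λ y → map (y ∷_) (allMonic F d))
    (Any.map (λ { refl → ∈-map⁺ (x ∷_) (allMonic-complete d v) }) (∈-allFin x))

  allMonic-unique : ∀ d → Unique (allMonic F d)
  allMonic-unique zero = [] ∷ []
  allMonic-unique (suc d) = UniqueP.concat⁺
    (AllP.map⁺ (All.tabulate (λ _ → UniqueP.map⁺ VecP.∷-injectiveʳ (allMonic-unique d))))
    (AllPairsP.map⁺ (AllPairs.map disjoint (UniqueP.allFin⁺ q)))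
    where
      disjoint : ∀ {x y} → x ≢ y → ∀ {w} → ¬ (w ∈ map (x ∷_) (allMonic F d) × w ∈ map (y ∷_) (allMonic F d))
      disjoint x≢y (w∈x , w∈y) with ∈-map⁻ (_ ∷_) w∈x | ∈-map⁻ (_ ∷_) w∈y
      ... | _ , _ , refl | _ , _ , w≡ = x≢y (VecP.∷-injectiveˡ w≡)

  full-injective : ∀ {d} (r p : Vec (Fin q) d) → full F r ≡ full F p → r ≡ p
  full-injective [] [] _ = refl
  full-injective (x ∷ r) (y ∷ p) xr≡yp =
    cong₂ _∷_ (ListP.∷-injectiveˡ xr≡yp) (full-injective r p (ListP.∷-injectiveʳ xr≡yp))

  divisor-same-degree : ∀ {d} (r p : Vec (Fin q) d) → Divides F d (full F r) p → r ≡ p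
  divisor-same-degree {d} r p (_ , h , rh≡p) = full-injective r p (≈-length⇒≡ _ _ r≈p
      (trans (length-snoc r 1#) (sym (length-snoc p 1#))))
    where
      empty : ∀ {k} (v : Vec (Fin q) k) → k ≡ 0 → toList v ≡ []
      empty [] _ = refl
      h≡1 : full F h ≡ 1# ∷ []
      h≡1 = cong (_++ 1# ∷ []) (empty h (n∸n≡0 d))
      r≈p : full F r ≈ full F p
      r≈p = ≈-trans (≈-sym (mul-oneʳ (full F r))) (≈-trans (mul-congʳ (full F r) (≡⇒≈ (sym h≡1))) (≡⇒≈ rh≡p))

  irreducible-∤-other-degree : ∀ {e d} (r : Vec (Fin q) e) (p : Vec (Fin q) d) → e ≢ d →
    Irreducible F r → Irreducible F p → ¬ Divides F e (full F r) p
  irreducible-∤-other-degree {e} r p e≢d (0<e , _) (_ , p-irr) r∣p with p-irr e r r∣p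
  ... | inj₁ refl = <-irrefl refl 0<e
  ... | inj₂ e≡d = e≢d e≡d

  IrreducibleFactor : ∀ {e m} → Vec (Fin q) e → Vec (Fin q) m → Set
  IrreducibleFactor {e} r f = Irreducible F r × Divides F e (full F r) f

  irreducibleFactors : ∀ {m} → Vec (Fin q) m → ℕ → ℕ
  irreducibleFactors f e = count (λ r → irreducible? F r ×-dec divides? F e (full F r) f) (allMonic F e)

  irreducibleFactors-vanish : ∀ {m} (f : Vec (Fin q) m) e → m < e → irreducibleFactors f e ≡ 0
  irreducibleFactors-vanish f e m<e = count-none _ (allMonic F e) λ _ _ (_ , e≤m , _) → <-irrefl refl (≤-trans m<e e≤m)

  module Quotient {d n} (p : Vec (Fin q) d) (f : Vec (Fin q) n) (h : Vec (Fin q) (n ∸ d))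
                  (p·h≡f : mul (full F p) (full F h) ≡ full F f) where

    divisor-of-quotient : ∀ {e} g → IsMonic e g → Divides F e g h → Divides F e g f
    divisor-of-quotient {e} g g-monic g∣h =
      ∣⇒Divides g g-monic f (∣-resp-≈ (∣-mulˡ (full F p) (Divides⇒∣ e g h g∣h)) (≡⇒≈ p·h≡f))

    factor-of-quotient : ∀ {e} (r : Vec (Fin q) e) → IrreducibleFactor r h → IrreducibleFactor r f
    factor-of-quotient r (r-irr , r∣h) = r-irr , divisor-of-quotient (full F r) (full-monic r) r∣h

    irreducible-divisor : ∀ {e} (r : Vec (Fin q) e) → Irreducible F r → ¬ Divides F e (full F r) p →
      Divides F e (full F r) f → Divides F e (full F r) h
    irreducible-divisor {e} r r-irr r∤p r∣f =
      Euclid.euclid r r-irr p h r∤p (∣-resp-≈ (Divides⇒∣ e (full F r) f r∣f) (≡⇒≈ (sym p·h≡f)))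

    module _ (f-squarefree : Squarefree F f) where

      factor-∤-quotient : Irreducible F p → ¬ Divides F d (full F p) h
      factor-∤-quotient (0<d , _) (_ , k , pk≡h) =
        f-squarefree d 0<d p (∣⇒Divides (mul P P) (square-monic p) f (divides (full F k) pp·k≈f))
        where
          P = full F p
          pp·k≈f : mul (mul P P) (full F k) ≈ full F f
          pp·k≈f = ≈-trans (mul-assoc P P (full F k)) (≈-trans (mul-congʳ P (≡⇒≈ pk≡h)) (≡⇒≈ p·h≡f))

      quotient-squarefree : Squarefree F h
      quotient-squarefree e 0<e s s²∣h =
        f-squarefree e 0<e s (divisor-of-quotient (mul (full F s) (full F s)) (square-monic s) s²∣h)

      module _ (p-irreducible : Irreducible F p) (d≤n : d ≤ n) where

        irreducibleFactors-quotient : ∀ e → irreducibleFactors f e ≡ irreducibleFactors h e + indicator (e ≟ d)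
        irreducibleFactors-quotient e with e ≟ d
        ... | no e≢d = trans (count-cong _ _ (allMonic F e) f⇒h (λ r _ → factor-of-quotient r)) (sym (+-identityʳ _))
          where
            f⇒h : ∀ r → r ∈ allMonic F e → IrreducibleFactor r f → IrreducibleFactor r h
            f⇒h r _ (r-irr , r∣f) =
              r-irr , irreducible-divisor r r-irr (irreducible-∤-other-degree r p e≢d r-irr p-irreducible) r∣f
        ... | yes refl = trans (count-one-more _ _ (allMonic F d) p (allMonic-unique d) (allMonic-complete d p)
                                 (λ (_ , p∣h) → factor-∤-quotient p-irreducible p∣h) (p-irreducible , d≤n , h , p·h≡f)
                                 f⇒h (λ r _ → factor-of-quotient r))
                               (+-comm 1 _)
          where
            f⇒h : ∀ r → r ∈ allMonic F d → IrreducibleFactor r f → IrreducibleFactor r h ⊎ r ≡ p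
            f⇒h r _ (r-irr , r∣f) with VecP.≡-dec FinP._≟_ r p
            ... | yes r≡p = inj₂ r≡p
            ... | no r≢p = inj₁ (r-irr , irreducible-divisor r r-irr (λ r∣p → r≢p (divisor-same-degree r p r∣p)) r∣f)

        numIrrFactors-quotient : numIrrFactors F f ≡ suc (numIrrFactors F h)
        numIrrFactors-quotient = begin
          sum (map (irreducibleFactors f) (upTo (suc n)))
            ≡⟨ sum-cong (upTo (suc n)) (λ e _ → irreducibleFactors-quotient e) ⟩
          sum (map (λ e → irreducibleFactors h e + indicator (e ≟ d)) (upTo (suc n)))
            ≡⟨ sum-+ {f = irreducibleFactors h} {g = λ e → indicator (e ≟ d)} (upTo (suc n)) ⟩
          sum (map (irreducibleFactors h) (upTo (suc n))) + sum (map (λ e → indicator (e ≟ d)) (upTo (suc n)))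
            ≡⟨ cong₂ _+_ h-part (sum-upTo-indicator d (suc n) (s≤s d≤n)) ⟩
          numIrrFactors F h + 1
            ≡⟨ +-comm _ 1 ⟩
          suc (numIrrFactors F h) ∎
          where
            n+1≡ : suc n ≡ d + suc (n ∸ d)
            n+1≡ = sym (trans (+-suc d (n ∸ d)) (cong suc (m+[n∸m]≡n d≤n)))
            h-part : sum (map (irreducibleFactors h) (upTo (suc n))) ≡ numIrrFactors F h
            h-part = trans (cong (λ t → sum (map (irreducibleFactors h) (upTo t))) n+1≡)
                       (sum-upTo-vanishing (irreducibleFactors h) (suc (n ∸ d)) d (λ i → irreducibleFactors-vanish h i))

  distinct-factors-degrees : ∀ {n d₁ d₂} (p₁ : Vec (Fin q) d₁) (p₂ : Vec (Fin q) d₂) (f : Vec (Fin q) n) →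
    Irreducible F p₂ → ¬ Divides F d₂ (full F p₂) p₁ →
    Divides F d₁ (full F p₁) f → Divides F d₂ (full F p₂) f → d₁ + d₂ ≤ n
  distinct-factors-degrees {n} {d₁} p₁ p₂ f p₂-irr p₂∤p₁ (d₁≤n , h , p₁h≡f) p₂∣f =
    subst (d₁ + _ ≤_) (m+[n∸m]≡n d₁≤n)
      (+-monoʳ-≤ d₁ (proj₁ (Quotient.irreducible-divisor p₁ f h p₁h≡f p₂ p₂-irr p₂∤p₁ p₂∣f)))

module DoubleCount {q : ℕ} (F : FiniteField q) (k n : ℕ) where

  open import Data.Nat using (suc; _+_; _≤?_; _≟_)
  open import Data.Nat.Properties
    using (≤-trans; ≤-reflexive; ≤-total; +-monoʳ-≤; +-monoˡ-≤; +-identityʳ; ∸-monoˡ-≤; m+n∸n≡m)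
  open import Data.Fin using (Fin)
  import Data.Fin.Properties as FinP
  open import Data.Vec using (Vec)
  import Data.Vec.Properties as VecP
  open import Data.List using (List; map; length; filter; upTo)
  open import Data.Nat.ListAction using (sum)
  open import Data.List.Membership.Propositional using (_∈_)
  open import Data.List.Membership.Propositional.Properties using (∈-concatMap⁻; ∈-map⁻; ∈-filter⁻)
  open import Data.List.Relation.Unary.Any as Any using ()
  import Data.List.Relation.Unary.Unique.Propositional.Properties as UniqueP
  open import Data.Product using (Σ; _×_; _,_; proj₁; proj₂)
  open import Data.Sum using (_⊎_; inj₁; inj₂)
  open import Data.Empty using (⊥; ⊥-elim)
  open import Relation.Nullary using (Dec; yes; no; ¬_)
  open import Relation.Nullary.Decidable using (_×-dec_; ¬?)
  open import Relation.Binary.PropositionalEquality using (_≡_; refl; sym; trans; cong; subst)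
  open Counting
  open Factorisation F

  Shape : ℕ → ∀ {m} → Vec (Fin q) m → Set
  Shape j f = Squarefree F f × numIrrFactors F f ≡ j

  shape? : ∀ j {m} (f : Vec (Fin q) m) → Dec (Shape j f)
  shape? j f = squarefree? F f ×-dec (numIrrFactors F f ≟ j)

  S : List (Vec (Fin q) n)
  S = filter (shape? k) (allMonic F n)

  smallIrreducibles : List (Σ ℕ (Vec (Fin q)))
  smallIrreducibles = irreduciblesUpTo F n

  small-degrees large-degrees : List ℕ
  small-degrees = filter (λ d → (2 * d) ≤? n) (upTo (suc n))
  large-degrees = filter (λ d → ¬? ((2 * d) ≤? n)) (upTo (suc n))

  pair-divides? : (dp : Σ ℕ (Vec (Fin q))) (f : Vec (Fin q) n) → Dec (Divides F (proj₁ dp) (full F (proj₂ dp)) f)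
  pair-divides? (d , p) f = divides? F d (full F p) f

  smallFactors : Vec (Fin q) n → ℕ
  smallFactors f = count (λ dp → pair-divides? dp f) smallIrreducibles

  smallIrreducibles-irreducible : ∀ dp → dp ∈ smallIrreducibles → Irreducible F (proj₂ dp)
  smallIrreducibles-irreducible dp dp∈
    with Any.satisfied (∈-concatMap⁻ (λ d → map (d ,_) (filter (irreducible? F) (allMonic F d))) {xs = small-degrees} dp∈)
  ... | d , dp∈d with ∈-map⁻ (d ,_) dp∈d
  ...   | p , p∈ , refl = proj₂ (∈-filter⁻ (irreducible? F) {xs = allMonic F d} p∈)

  large-degree : ∀ d → d ∈ large-degrees → ¬ (d + d ≤ n)
  large-degree d d∈ d+d≤n = proj₂ (∈-filter⁻ (λ d → ¬? ((2 * d) ≤? n)) {xs = upTo (suc n)} d∈)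
                              (subst (_≤ n) (cong (d +_) (sym (+-identityʳ d))) d+d≤n)

  -- Counting by p: the f ∈ S divisible by the irreducible p inject, via
  -- f ↦ f / p, into the squarefree polynomials of degree n - deg p with
  -- k - 1 irreducible factors.
  multiples-bound : ∀ d (p : Vec (Fin q) d) → Irreducible F p → count (pair-divides? (d , p)) S ≤ Π′ F (k ∸ 1) (n ∸ d)
  multiples-bound d p p-irr =
    subst (_≤ Π′ F (k ∸ 1) (n ∸ d)) (sym (count-filter (shape? k) (pair-divides? (d , p)) (allMonic F n)))
      (count-injection (λ f → shape? k f ×-dec pair-divides? (d , p) f) (shape? (k ∸ 1))
        quotient quotient-shape quotient-injective
        (allMonic F n) (allMonic F (n ∸ d)) (allMonic-unique n) (λ _ _ → allMonic-complete _ _))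
    where
      quotient : ∀ f → Shape k f × Divides F d (full F p) f → Vec (Fin q) (n ∸ d)
      quotient f (_ , _ , h , _) = h
      quotient-shape : ∀ f f∈ → Shape (k ∸ 1) (quotient f f∈)
      quotient-shape f ((f-sqf , f-k) , (d≤n , h , ph≡f)) =
        quotient-squarefree f-sqf , cong (_∸ 1) (trans (sym (numIrrFactors-quotient f-sqf p-irr d≤n)) f-k)
        where open Quotient p f h ph≡f
      quotient-injective : ∀ f g f∈ g∈ → quotient f f∈ ≡ quotient g g∈ → f ≡ g
      quotient-injective f g (_ , _ , h , ph≡f) (_ , _ , _ , ph≡g) refl = full-injective f g (trans (sym ph≡f) ph≡g)

  smallFactors-by-degree : ∀ f → smallFactors f ≡ sum (map (irreducibleFactors f) small-degrees)
  smallFactors-by-degree f =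
    trans (count-concatMap (λ dp → pair-divides? dp f) (λ d → map (d ,_) (irreducibles d)) small-degrees)
      (sum-cong small-degrees λ d _ → trans (count-map (λ dp → pair-divides? dp f) (d ,_) (irreducibles d))
        (count-filter (irreducible? F) (λ p → pair-divides? (d , p) f) (allMonic F d)))
    where
      irreducibles : ∀ d → List (Vec (Fin q) d)
      irreducibles d = filter (irreducible? F) (allMonic F d)

  -- f has at most one irreducible factor of degree > n/2: two of them
  -- would have degrees summing to more than n.
  large-factors : ∀ f → sum (map (irreducibleFactors f) large-degrees) ≤ 1
  large-factors f = sum-≤1 (irreducibleFactors f) large-degrees
      (UniqueP.filter⁺ (λ d → ¬? ((2 * d) ≤? n)) (UniqueP.upTo⁺ (suc n))) one-per-degree one-degree
    where
      one-per-degree : ∀ d → d ∈ large-degrees → irreducibleFactors f d ≤ 1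
      one-per-degree d d∈ = count-≤1 _ (allMonic F d) (allMonic-unique d) same
        where
          same : ∀ r s → r ∈ allMonic F d → s ∈ allMonic F d →
            IrreducibleFactor r f → IrreducibleFactor s f → r ≡ s
          same r s _ _ (_ , r∣f) (s-irr , s∣f) with VecP.≡-dec FinP._≟_ r s
          ... | yes r≡s = r≡s
          ... | no r≢s = ⊥-elim (large-degree d d∈ (distinct-factors-degrees r s f s-irr
                           (λ s∣r → r≢s (sym (divisor-same-degree s r s∣r))) r∣f s∣f))
      one-degree : ∀ d₁ d₂ → d₁ ∈ large-degrees → d₂ ∈ large-degrees →
        1 ≤ irreducibleFactors f d₁ → 1 ≤ irreducibleFactors f d₂ → d₁ ≡ d₂
      one-degree d₁ d₂ d₁∈ d₂∈ pos₁ pos₂ with d₁ ≟ d₂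
      ... | yes d₁≡d₂ = d₁≡d₂
      ... | no d₁≢d₂ with count-witness _ (allMonic F d₁) pos₁ | count-witness _ (allMonic F d₂) pos₂
      ...   | r , _ , r-irr , r∣f | s , _ , s-irr , s∣f = ⊥-elim (too-large (≤-total d₁ d₂))
        where
          d₁+d₂≤n : d₁ + d₂ ≤ n
          d₁+d₂≤n = distinct-factors-degrees r s f s-irr
                      (irreducible-∤-other-degree s r (λ d₂≡d₁ → d₁≢d₂ (sym d₂≡d₁)) s-irr r-irr) r∣f s∣f
          too-large : d₁ ≤ d₂ ⊎ d₂ ≤ d₁ → ⊥
          too-large (inj₁ d₁≤d₂) = large-degree d₁ d₁∈ (≤-trans (+-monoʳ-≤ d₁ d₁≤d₂) d₁+d₂≤n)
          too-large (inj₂ d₂≤d₁) = large-degree d₂ d₂∈ (≤-trans (+-monoˡ-≤ d₂ d₂≤d₁) d₁+d₂≤n)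

  many-small-factors : ∀ f → Shape k f → k ∸ 1 ≤ smallFactors f
  many-small-factors f (_ , f-k) = subst (k ∸ 1 ≤_) (sym (smallFactors-by-degree f))
      (≤-trans (∸-monoˡ-≤ 1 k≤A+1) (≤-reflexive (m+n∸n≡m A 1)))
    where
      A = sum (map (irreducibleFactors f) small-degrees)
      k≤A+1 : k ≤ A + 1
      k≤A+1 = subst (_≤ A + 1) (trans (sym (sum-split (λ d → (2 * d) ≤? n) (irreducibleFactors f) (upTo (suc n)))) f-k)
                (+-monoʳ-≤ A (large-factors f))

  double-count : (k ∸ 1) * Π′ F k n ≤ rhsSum F (k ∸ 1) n
  double-count = begin
    (k ∸ 1) * length S                       ≤⟨ sum-lower (k ∸ 1) S by-f ⟩
    sum (map smallFactors S)                 ≡⟨ count-swap (λ f dp → pair-divides? dp f) S smallIrreducibles ⟩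
    sum (map multiplesOf smallIrreducibles)  ≤⟨ sum-mono smallIrreducibles by-p ⟩
    rhsSum F (k ∸ 1) n                       ∎
    where
      open Data.Nat.Properties.≤-Reasoning
      multiplesOf : Σ ℕ (Vec (Fin q)) → ℕ
      multiplesOf dp = count (pair-divides? dp) S
      by-f : ∀ f → f ∈ S → k ∸ 1 ≤ smallFactors f
      by-f f f∈S = many-small-factors f (proj₂ (∈-filter⁻ (shape? k) {xs = allMonic F n} f∈S))
      by-p : ∀ dp → dp ∈ smallIrreducibles → multiplesOf dp ≤ Π′ F (k ∸ 1) (n ∸ proj₁ dp)
      by-p (d , p) dp∈ = multiples-bound d p (smallIrreducibles-irreducible (d , p) dp∈)

-- Lemma 5.3.
lemma5p3 : ∀ {q} → IsPrimePower q → (F : FiniteField q) →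
    ∀ k n → 1 ≤ k → 1 ≤ n →
    (k ∸ 1) * Π′ F k n ≤ rhsSum F (k ∸ 1) n
lemma5p3 _ F k n _ _ = DoubleCount.double-count F k n
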